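{- $D(18,\{3,4\})\ge 30$; equivalently, every $\{K_3,K_4\}$-decomposition of $K_{18}$ contains at least $9$ copies of $K_3$.
   Context: A $\{K_3,K_4\}$-decomposition of $K_v$ is a collection of subgraphs of $K_v$, each isomorphic to $K_3$ or $K_4$, whose edge sets partition $E(K_v)$. $D(v,\{3,4\})$ denotes the minimum number of subgraphs in a $\{K_3,K_4\}$-decomposition of $K_v$. -}

module Defs where

open import Data.Nat using (ℕ; _≥_)
open import Data.Fin using (Fin)
open import Data.Fin.Properties using (_≟_)
open import Data.List using (List; length; filter)
open import Data.List.Relation.Unary.Unique.Propositional using (Unique)
import Data.List.Membership.DecPropositional as DecMem
open import Relation.Nullary using (Dec)
open import Data.List.Membership.Propositional using (_∈_)
open import Data.List.Relation.Unary.Any using (any?)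
open import Data.List.Relation.Unary.All using (All)
open import Data.Product using (_×_; Σ)
open import Data.Sum using (_⊎_)
open import Relation.Nullary using (¬_)
open import Relation.Nullary.Decidable using (_×-dec_)
open import Relation.Binary.PropositionalEquality using (_≡_)

-- A block on vertex set Fin v: a list of distinct vertices (the vertex set of
-- a complete subgraph K_3 or K_4 of K_v).
record Block (v : ℕ) : Set where
  constructor block
  field
    verts    : List (Fin v)
    distinct : Unique verts
    size34   : length verts ≡ 3 ⊎ length verts ≡ 4

open Block public

mem? : ∀ {v} (x : Fin v) (xs : List (Fin v)) → Dec (x ∈ xs)
mem? {v} = DecMem._∈?_ (_≟_ {n = v})

blocksContaining : ∀ {v} → Fin v → Fin v → List (Block v) → List (Block v)
blocksContaining {v} x y =
  filter (λ B → mem? x (verts B) ×-dec mem? y (verts B))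

IsK34Decomposition : (v : ℕ) → List (Block v) → Set
IsK34Decomposition v Bs =
  (x y : Fin v) → ¬ (x ≡ y) → length (blocksContaining x y Bs) ≡ 1

module Submission where

-- At a vertex lying on a triangles and b copies of K₄ we have 2a + 3b = 17, so (a, b) is
-- (1,5), (4,3) or (7,1).  Counting all 153 edges gives t + 2f = 51 for t triangles and f
-- copies of K₄; hence there are (51 + t)/2 blocks, t is odd, and t ≥ 6 because every vertex
-- lies on a triangle.  It remains to rule out t = 7.  Then ∑ a = 21 forces a single vertex x
-- of type (4,3), all others being of type (1,5).  The 8 triangle mates of x (the vertices
-- sharing a triangle with x) and its 9 K₄ mates meet each other only in copies of K₄
-- avoiding x; let nₖ count those containing k triangle mates.  Double counting their
-- incidences with both kinds of mates and the edges between the two kinds, together with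
-- parity (every triangle mate has 9 K₄ mates as neighbours there), forces n₀ = n₄ = 0 and
-- n₁ = 1.  Locally, each triangle mate z then lies on a K₄ with three triangle mates, whose
-- K₄ mate y lies on the unique K₄ with one triangle mate; choosing z in that K₄ covers the
-- edge zy twice.

open import Data.Bool.Base using (true; false; if_then_else_)
open import Data.Fin.Base using (Fin; zero; suc; toℕ)
open import Data.Fin.Properties using (_≟_)
open import Data.List.Base using (List; []; _∷_; length; filter; lookup)
open import Data.List.Relation.Unary.All.Properties using (All¬⇒¬Any)
open import Data.List.Relation.Unary.AllPairs using ([]; _∷_)
open import Data.List.Relation.Unary.Unique.Propositional using (Unique)
open import Data.List.Membership.Propositional using (_∈_)
open import Data.Nat.Base
open import Data.Nat.Properties hiding (_≟_)
open import Data.Nat.Properties using () renaming (_≟_ to _≟ℕ_)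
open import Data.Empty using (⊥)
open import Data.Product using (_×_; _,_; proj₁; proj₂; ∃-syntax)
open import Data.Sum using (_⊎_; inj₁; inj₂)
open import Function.Base using (_∘_)
open import Relation.Nullary using (Dec; does; yes; no; ¬_; ¬?)
open import Relation.Nullary.Decidable using (dec-true; dec-false; _×-dec_)
open import Relation.Nullary.Negation using (contradiction)
open import Relation.Unary using (Pred; Decidable)
open import Relation.Binary.PropositionalEquality
open ≡-Reasoning
open import Data.Nat.Tactic.RingSolver using (solve-∀)
open import Algebra.Properties.CommutativeSemigroup *-commutativeSemigroup using (x∙yz≈y∙xz; x∙yz≈yx∙z)
open import Algebra.Properties.Semiring.Sum +-*-semiring
  using (sum; sum-syntax; sum-cong-≗; sum-replicate-zero; ∑-distrib-+; ∑-comm; *-distribˡ-sum; *-distribʳ-sum)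

open import Defs

-- Indicators and finite sums

𝟙 : ∀ {a} {A : Set a} → Dec A → ℕ
𝟙 a? = if does a? then 1 else 0

module _ {a} {A : Set a} (a? : Dec A) where

  𝟙-yes : A → 𝟙 a? ≡ 1
  𝟙-yes p rewrite dec-true a? p = refl

  𝟙-no : ¬ A → 𝟙 a? ≡ 0
  𝟙-no ¬p rewrite dec-false a? ¬p = refl

  𝟙-¬? : 𝟙 (¬? a?) + 𝟙 a? ≡ 1
  𝟙-¬? with does a?
  ... | true  = refl
  ... | false = refl

  𝟙≤1 : 𝟙 a? ≤ 1
  𝟙≤1 with does a?
  ... | true  = ≤-refl
  ... | false = z≤n

𝟙-pos : ∀ {a} {A : Set a} (a? : Dec A) → 0 < 𝟙 a? → A
𝟙-pos (yes a) _ = a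
𝟙-pos (no _)  ()

𝟙-×-dec : ∀ {a b} {A : Set a} {B : Set b} (a? : Dec A) (b? : Dec B) →
          𝟙 (a? ×-dec b?) ≡ 𝟙 a? * 𝟙 b?
𝟙-×-dec a? b? with does a? | does b?
... | true  | true  = refl
... | true  | false = refl
... | false | _     = refl

m+n≡1⇒ : ∀ {m n} → m + n ≡ 1 → (m ≡ 1 × n ≡ 0) ⊎ (m ≡ 0 × n ≡ 1)
m+n≡1⇒ {zero}        refl = inj₂ (refl , refl)
m+n≡1⇒ {suc zero}    refl = inj₁ (refl , refl)

≡1⇒0< : ∀ {m} → m ≡ 1 → 0 < m
≡1⇒0< refl = z<s

0<m*n⇒0<m×0<n : ∀ {m n} → 0 < m * n → 0 < m × 0 < n
0<m*n⇒0<m×0<n {suc m} {suc n} _   = z<s , z<s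
0<m*n⇒0<m×0<n {suc m} {zero}  0<p = contradiction (subst (0 <_) (*-zeroʳ m) 0<p) λ ()

∑-const : ∀ n c → ∑[ i < n ] c ≡ n * c
∑-const zero    c = refl
∑-const (suc n) c = cong (c +_) (∑-const n c)

∑-mono-≤ : ∀ {n} {f g : Fin n → ℕ} → (∀ i → f i ≤ g i) → sum f ≤ sum g
∑-mono-≤ {zero}  f≤g = z≤n
∑-mono-≤ {suc n} f≤g = +-mono-≤ (f≤g zero) (∑-mono-≤ (f≤g ∘ suc))

≤-∑ : ∀ {n} (f : Fin n → ℕ) i → f i ≤ sum f
≤-∑ f zero    = m≤m+n _ _
≤-∑ f (suc i) = ≤-trans (≤-∑ (f ∘ suc) i) (m≤n+m _ _)

+-≤-∑ : ∀ {n} (f : Fin n → ℕ) {i j} → i ≢ j → f i + f j ≤ sum f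
+-≤-∑ f {zero}  {zero}  i≢j = contradiction refl i≢j
+-≤-∑ f {zero}  {suc j} _   = +-monoʳ-≤ (f zero) (≤-∑ (f ∘ suc) j)
+-≤-∑ f {suc i} {zero}  _   = subst (_≤ sum f) (+-comm (f zero) (f (suc i))) (+-monoʳ-≤ (f zero) (≤-∑ (f ∘ suc) i))
+-≤-∑ f {suc i} {suc j} i≢j = ≤-trans (+-≤-∑ (f ∘ suc) (i≢j ∘ cong suc)) (m≤n+m _ _)

∑-*-cong : ∀ {n} (w : Fin n → ℕ) {f g : Fin n → ℕ} → (∀ i → w i ≢ 0 → f i ≡ g i) →
           ∑[ i < n ] (w i * f i) ≡ ∑[ i < n ] (w i * g i)
∑-*-cong w {f} {g} f≗g = sum-cong-≗ pointwise
  where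
  pointwise : ∀ i → w i * f i ≡ w i * g i
  pointwise i with w i in wi≡
  ... | zero  = refl
  ... | suc k = cong (suc k *_) (f≗g i λ wi≡0 → contradiction (trans (sym wi≡) wi≡0) λ ())

∑-*-mono-≤ : ∀ {n} (w : Fin n → ℕ) {f g : Fin n → ℕ} → (∀ i → w i ≢ 0 → f i ≤ g i) →
             ∑[ i < n ] (w i * f i) ≤ ∑[ i < n ] (w i * g i)
∑-*-mono-≤ w {f} {g} f≤g = ∑-mono-≤ pointwise
  where
  pointwise : ∀ i → w i * f i ≤ w i * g i
  pointwise i with w i in wi≡
  ... | zero  = z≤n
  ... | suc k = *-monoʳ-≤ (suc k) (f≤g i λ wi≡0 → contradiction (trans (sym wi≡) wi≡0) λ ())

∑≤1⇒unique : ∀ {n} (f : Fin n → ℕ) {i j} → sum f ≤ 1 → 0 < f i → 0 < f j → i ≡ j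
∑≤1⇒unique f {i} {j} ∑f≤1 0<fi 0<fj with i ≟ j
... | yes i≡j = i≡j
... | no i≢j  = contradiction (≤-trans (+-mono-≤ 0<fi 0<fj) (≤-trans (+-≤-∑ f i≢j) ∑f≤1)) λ { (s≤s ()) }

∑-pos⇒∃ : ∀ {n} (f : Fin n → ℕ) → 0 < sum f → ∃[ i ] 0 < f i
∑-pos⇒∃ {suc n} f 0<∑f with f zero in f0≡
... | suc _ = zero , subst (0 <_) (sym f0≡) z<s
... | zero with ∑-pos⇒∃ (f ∘ suc) 0<∑f
...   | i , 0<fi = suc i , 0<fi

∑-point : ∀ {n} (f : Fin n → ℕ) i → ∑[ j < n ] (𝟙 (j ≟ i) * f j) ≡ f i
∑-point {suc n} f zero    = trans (cong₂ _+_ (*-identityˡ (f zero)) (sum-replicate-zero n)) (+-identityʳ (f zero))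
∑-point {suc n} f (suc i) = ∑-point (f ∘ suc) i

∑-𝟙-≟ : ∀ {n} (i : Fin n) → ∑[ j < n ] 𝟙 (j ≟ i) ≡ 1
∑-𝟙-≟ {n} i = trans (sum-cong-≗ (λ j → sym (*-identityʳ (𝟙 (j ≟ i))))) (∑-point (λ _ → 1) i)

others : ∀ {n} → Fin n → Fin n → ℕ
others x u = 𝟙 (¬? (u ≟ x))

others-self : ∀ {n} (x : Fin n) → others x x ≡ 0
others-self x = 𝟙-no (¬? (x ≟ x)) λ x≢x → x≢x refl

∑-≢ : ∀ {n} (x : Fin n) → suc (sum (others x)) ≡ n
∑-≢ {n} x = begin
  suc (sum (others x))                    ≡⟨ +-comm 1 _ ⟩
  sum (others x) + 1                      ≡⟨ cong (sum (others x) +_) (∑-𝟙-≟ x) ⟨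
  sum (others x) + ∑[ u < n ] 𝟙 (u ≟ x)   ≡⟨ ∑-distrib-+ (others x) (λ u → 𝟙 (u ≟ x)) ⟨
  ∑[ u < n ] (others x u + 𝟙 (u ≟ x))     ≡⟨ sum-cong-≗ (λ u → 𝟙-¬? (u ≟ x)) ⟩
  ∑[ u < n ] 1                            ≡⟨ ∑-const n 1 ⟩
  n * 1                                   ≡⟨ *-identityʳ n ⟩
  n                                       ∎

∑-pick : ∀ {n} (p h : Fin n → ℕ) {i} → sum p ≡ 1 → p i ≡ 1 → ∑[ j < n ] (p j * h j) ≡ h i
∑-pick {n} p h {i} ∑p≡1 pi≡1 = trans (sum-cong-≗ pointwise) (∑-point h i)
  where
  pointwise : ∀ j → p j * h j ≡ 𝟙 (j ≟ i) * h j
  pointwise j with j ≟ i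
  ... | yes refl = cong (_* h j) pi≡1
  ... | no j≢i   = cong (_* h j) (n≤0⇒n≡0 (+-cancelˡ-≤ 1 (p j) 0 1+pj≤1))
    where
    1+pj≤1 : 1 + p j ≤ 1
    1+pj≤1 = subst (λ k → k + p j ≤ 1) pi≡1 (≤-trans (+-≤-∑ p (j≢i ∘ sym)) (≤-reflexive ∑p≡1))

length-filter≡∑ : ∀ {a p} {A : Set a} {P : Pred A p} (P? : Decidable P) (xs : List A) →
                  length (filter P? xs) ≡ ∑[ i < length xs ] 𝟙 (P? (lookup xs i))
length-filter≡∑ P? []       = refl
length-filter≡∑ P? (x ∷ xs) with does (P? x)
... | true  = cong suc (length-filter≡∑ P? xs)
... | false = length-filter≡∑ P? xs

∑-𝟙-∈ : ∀ {n} {xs : List (Fin n)} → Unique xs → ∑[ u < n ] 𝟙 (mem? u xs) ≡ length xs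
∑-𝟙-∈ {n} {[]}     []             = sum-replicate-zero n
∑-𝟙-∈ {n} {y ∷ xs} (y∉xs ∷ xs!) = begin
  ∑[ u < n ] 𝟙 (mem? u (y ∷ xs))                   ≡⟨ sum-cong-≗ split ⟩
  ∑[ u < n ] (𝟙 (u ≟ y) + 𝟙 (mem? u xs))           ≡⟨ ∑-distrib-+ (λ u → 𝟙 (u ≟ y)) (λ u → 𝟙 (mem? u xs)) ⟩
  ∑[ u < n ] 𝟙 (u ≟ y) + ∑[ u < n ] 𝟙 (mem? u xs)  ≡⟨ cong₂ _+_ (∑-𝟙-≟ y) (∑-𝟙-∈ xs!) ⟩
  suc (length xs)                                  ∎
  where
  split : ∀ u → 𝟙 (mem? u (y ∷ xs)) ≡ 𝟙 (u ≟ y) + 𝟙 (mem? u xs)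
  split u with u ≟ y | mem? u xs
  ... | yes refl | yes y∈xs = contradiction y∈xs (All¬⇒¬Any y∉xs)
  ... | yes refl | no _     = refl
  ... | no _     | yes _    = refl
  ... | no _     | no _     = refl

-- Incidence between vertices and blocks

module Incidence {v} (Bs : List (Block v)) where

  #blocks : ℕ
  #blocks = length Bs

  blockAt : Fin #blocks → Block v
  blockAt = lookup Bs

  _∈ᵇ_ : Fin v → Fin #blocks → Set
  u ∈ᵇ i = u ∈ verts (blockAt i)

  _∈ᵇ?_ : ∀ u i → Dec (u ∈ᵇ i)
  u ∈ᵇ? i = mem? u (verts (blockAt i))

  inc notInc : Fin v → Fin #blocks → ℕ
  inc    u i = 𝟙 (u ∈ᵇ? i)
  notInc u i = 𝟙 (¬? (u ∈ᵇ? i))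

  size : Fin #blocks → ℕ
  size i = length (verts (blockAt i))

  isTriangle isK4 : Fin #blocks → ℕ
  isTriangle i = 𝟙 (size i ≟ℕ 3)
  isK4       i = 𝟙 (size i ≟ℕ 4)

  onBlock : (Fin v → ℕ) → Fin #blocks → ℕ
  onBlock w i = ∑[ u < v ] (inc u i * w u)

  atVertex : (Fin #blocks → ℕ) → Fin v → ℕ
  atVertex g u = ∑[ i < #blocks ] (inc u i * g i)

  trianglesAt K4sAt : Fin v → ℕ
  trianglesAt = atVertex isTriangle
  K4sAt       = atVertex isK4

  #triangles #K4s : ℕ
  #triangles = ∑[ i < #blocks ] isTriangle i
  #K4s       = ∑[ i < #blocks ] isK4 i

  isTriangle+isK4≡1 : ∀ i → isTriangle i + isK4 i ≡ 1
  isTriangle+isK4≡1 i with size34 (blockAt i)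
  ... | inj₁ size≡3 rewrite size≡3 = refl
  ... | inj₂ size≡4 rewrite size≡4 = refl

  *-isTriangle : ∀ (F : ℕ → ℕ) i → F (size i) * isTriangle i ≡ F 3 * isTriangle i
  *-isTriangle F i with size i ≟ℕ 3
  ... | yes size≡3 = cong (λ k → F k * isTriangle i) size≡3
  ... | no size≢3  rewrite 𝟙-no (size i ≟ℕ 3) size≢3 = trans (*-zeroʳ (F (size i))) (sym (*-zeroʳ (F 3)))

  *-isK4 : ∀ (F : ℕ → ℕ) i → F (size i) * isK4 i ≡ F 4 * isK4 i
  *-isK4 F i with size i ≟ℕ 4
  ... | yes size≡4 = cong (λ k → F k * isK4 i) size≡4
  ... | no size≢4  rewrite 𝟙-no (size i ≟ℕ 4) size≢4 = trans (*-zeroʳ (F (size i))) (sym (*-zeroʳ (F 4)))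

  length≡#triangles+#K4s : length Bs ≡ #triangles + #K4s
  length≡#triangles+#K4s = begin
    length Bs                                 ≡⟨ *-identityʳ (length Bs) ⟨
    #blocks * 1                               ≡⟨ ∑-const #blocks 1 ⟨
    ∑[ i < #blocks ] 1                        ≡⟨ sum-cong-≗ isTriangle+isK4≡1 ⟨
    ∑[ i < #blocks ] (isTriangle i + isK4 i)  ≡⟨ ∑-distrib-+ isTriangle isK4 ⟩
    #triangles + #K4s                         ∎

  size∸1 : ∀ i → size i ∸ 1 ≡ 2 * isTriangle i + 3 * isK4 i
  size∸1 i = begin
    size i ∸ 1                                              ≡⟨ *-identityʳ (size i ∸ 1) ⟨
    (size i ∸ 1) * 1                                        ≡⟨ cong ((size i ∸ 1) *_) (isTriangle+isK4≡1 i) ⟨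
    (size i ∸ 1) * (isTriangle i + isK4 i)                  ≡⟨ *-distribˡ-+ (size i ∸ 1) (isTriangle i) (isK4 i) ⟩
    (size i ∸ 1) * isTriangle i + (size i ∸ 1) * isK4 i     ≡⟨ cong₂ _+_ (*-isTriangle (_∸ 1) i) (*-isK4 (_∸ 1) i) ⟩
    2 * isTriangle i + 3 * isK4 i                           ∎

  onBlock-cong : ∀ {w w′} i → (∀ u → u ∈ᵇ i → w u ≡ w′ u) → onBlock w i ≡ onBlock w′ i
  onBlock-cong {w} {w′} i w≗w′ = sum-cong-≗ pointwise
    where
    pointwise : ∀ u → inc u i * w u ≡ inc u i * w′ u
    pointwise u with u ∈ᵇ? i
    ... | yes u∈i = cong (1 *_) (w≗w′ u u∈i)
    ... | no _    = refl

  atVertex-cong : ∀ {g g′} u → (∀ i → u ∈ᵇ i → g i ≡ g′ i) → atVertex g u ≡ atVertex g′ u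
  atVertex-cong {g} {g′} u g≗g′ = sum-cong-≗ pointwise
    where
    pointwise : ∀ i → inc u i * g i ≡ inc u i * g′ i
    pointwise i with u ∈ᵇ? i
    ... | yes u∈i = cong (1 *_) (g≗g′ i u∈i)
    ... | no _    = refl

  atVertex-+ : ∀ g h u → atVertex (λ i → g i + h i) u ≡ atVertex g u + atVertex h u
  atVertex-+ g h u = trans (sum-cong-≗ (λ i → *-distribˡ-+ (inc u i) (g i) (h i)))
                           (∑-distrib-+ (λ i → inc u i * g i) (λ i → inc u i * h i))

  atVertex-* : ∀ c g u → atVertex (λ i → c * g i) u ≡ c * atVertex g u
  atVertex-* c g u = trans (sum-cong-≗ (λ i → x∙yz≈y∙xz (inc u i) c (g i)))
                           (sym (*-distribˡ-sum c (λ i → inc u i * g i)))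

  ≤-atVertex : ∀ g {u i} → u ∈ᵇ i → g i ≤ atVertex g u
  ≤-atVertex g {u} {i} u∈i =
    subst (_≤ atVertex g u) (trans (cong (_* g i) (𝟙-yes (u ∈ᵇ? i) u∈i)) (*-identityˡ (g i)))
          (≤-∑ (λ j → inc u j * g j) i)

  atVertex≡0 : ∀ g {u i} → atVertex g u ≡ 0 → u ∈ᵇ i → g i ≡ 0
  atVertex≡0 g {u} {i} g≡0 u∈i = n≤0⇒n≡0 (subst (g i ≤_) g≡0 (≤-atVertex g u∈i))

  onBlock-pos⇒∃ : ∀ w {i} → 0 < onBlock w i → ∃[ u ] (u ∈ᵇ i × 0 < w u)
  onBlock-pos⇒∃ w {i} 0<onBlock with ∑-pos⇒∃ (λ u → inc u i * w u) 0<onBlock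
  ... | u , 0<term with u ∈ᵇ? i
  ...   | yes u∈i = u , u∈i , subst (0 <_) (+-identityʳ (w u)) 0<term
  ...   | no _    = contradiction 0<term λ ()

  onBlock-1≡size : ∀ i → onBlock (λ _ → 1) i ≡ size i
  onBlock-1≡size i = trans (sum-cong-≗ (λ u → *-identityʳ (inc u i))) (∑-𝟙-∈ (distinct (blockAt i)))

  onBlock-≢ : ∀ x i → onBlock (others x) i + inc x i ≡ size i
  onBlock-≢ x i = begin
    onBlock (others x) i + inc x i                   ≡⟨ cong (onBlock (others x) i +_) (∑-point (λ u → inc u i) x) ⟨
    onBlock (others x) i + ∑[ u < v ] (𝟙 (u ≟ x) * inc u i)
      ≡⟨ cong (onBlock (others x) i +_) (sum-cong-≗ (λ u → *-comm (𝟙 (u ≟ x)) (inc u i))) ⟩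
    onBlock (others x) i + onBlock (λ u → 𝟙 (u ≟ x)) i
      ≡⟨ ∑-distrib-+ (λ u → inc u i * others x u) (λ u → inc u i * 𝟙 (u ≟ x)) ⟨
    ∑[ u < v ] (inc u i * others x u + inc u i * 𝟙 (u ≟ x))
      ≡⟨ sum-cong-≗ (λ u → trans (sym (*-distribˡ-+ (inc u i) _ _)) (cong (inc u i *_) (𝟙-¬? (u ≟ x)))) ⟩
    onBlock (λ _ → 1) i                                            ≡⟨ onBlock-1≡size i ⟩
    size i                                                         ∎

  onBlock-+ : ∀ w w′ i → onBlock (λ u → w u + w′ u) i ≡ onBlock w i + onBlock w′ i
  onBlock-+ w w′ i = trans (sum-cong-≗ (λ u → *-distribˡ-+ (inc u i) (w u) (w′ u)))
                           (∑-distrib-+ (λ u → inc u i * w u) (λ u → inc u i * w′ u))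

  onBlock-*ʳ : ∀ w c i → onBlock (λ u → w u * c) i ≡ onBlock w i * c
  onBlock-*ʳ w c i = trans (sum-cong-≗ (λ u → sym (*-assoc (inc u i) (w u) c)))
                           (sym (*-distribʳ-sum c (λ u → inc u i * w u)))

  onBlock-≢-through : ∀ {x i} → x ∈ᵇ i → onBlock (others x) i ≡ size i ∸ 1
  onBlock-≢-through {x} {i} x∈i = begin
    onBlock (others x) i                ≡⟨ m+n∸n≡m _ 1 ⟨
    onBlock (others x) i + 1 ∸ 1        ≡⟨ cong (λ k → onBlock (others x) i + k ∸ 1) (𝟙-yes (x ∈ᵇ? i) x∈i) ⟨
    onBlock (others x) i + inc x i ∸ 1  ≡⟨ cong (_∸ 1) (onBlock-≢ x i) ⟩
    size i ∸ 1                                       ∎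

  ∑-atVertex : ∀ (w : Fin v → ℕ) g →
               ∑[ u < v ] (w u * atVertex g u) ≡ ∑[ i < #blocks ] (onBlock w i * g i)
  ∑-atVertex w g = begin
    ∑[ u < v ] (w u * atVertex g u)                     ≡⟨ sum-cong-≗ (λ u → *-distribˡ-sum (w u) (λ i → inc u i * g i)) ⟩
    ∑[ u < v ] ∑[ i < #blocks ] (w u * (inc u i * g i))
      ≡⟨ sum-cong-≗ (λ u → sum-cong-≗ (λ i → x∙yz≈yx∙z (w u) (inc u i) (g i))) ⟩
    ∑[ u < v ] ∑[ i < #blocks ] (inc u i * w u * g i)   ≡⟨ ∑-comm (λ u i → inc u i * w u * g i) ⟩
    ∑[ i < #blocks ] ∑[ u < v ] (inc u i * w u * g i)
      ≡⟨ sum-cong-≗ (λ i → *-distribʳ-sum (g i) (λ u → inc u i * w u)) ⟨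
    ∑[ i < #blocks ] (onBlock w i * g i)                ∎

  handshake : ∀ g → ∑[ u < v ] atVertex g u ≡ ∑[ i < #blocks ] (size i * g i)
  handshake g = begin
    ∑[ u < v ] atVertex g u                  ≡⟨ sum-cong-≗ (λ u → *-identityˡ (atVertex g u)) ⟨
    ∑[ u < v ] (1 * atVertex g u)            ≡⟨ ∑-atVertex (λ _ → 1) g ⟩
    ∑[ i < #blocks ] (onBlock (λ _ → 1) i * g i) ≡⟨ sum-cong-≗ (λ i → cong (_* g i) (onBlock-1≡size i)) ⟩
    ∑[ i < #blocks ] (size i * g i)          ∎

  ∑-trianglesAt : ∑[ u < v ] trianglesAt u ≡ 3 * #triangles
  ∑-trianglesAt = trans (handshake isTriangle)
    (trans (sum-cong-≗ (*-isTriangle (λ k → k))) (sym (*-distribˡ-sum 3 isTriangle)))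

  ∑-K4sAt : ∑[ u < v ] K4sAt u ≡ 4 * #K4s
  ∑-K4sAt = trans (handshake isK4)
    (trans (sum-cong-≗ (*-isK4 (λ k → k))) (sym (*-distribˡ-sum 4 isK4)))

  ∑-excess : (∀ u → 1 ≤ trianglesAt u) → v + ∑[ u < v ] (trianglesAt u ∸ 1) ≡ 3 * #triangles
  ∑-excess on-triangle = begin
    v + ∑[ u < v ] (trianglesAt u ∸ 1)
      ≡⟨ cong (_+ ∑[ u < v ] (trianglesAt u ∸ 1)) (sym (trans (∑-const v 1) (*-identityʳ v))) ⟩
    ∑[ u < v ] 1 + ∑[ u < v ] (trianglesAt u ∸ 1)        ≡⟨ ∑-distrib-+ (λ _ → 1) (λ u → trianglesAt u ∸ 1) ⟨
    ∑[ u < v ] (1 + (trianglesAt u ∸ 1))                 ≡⟨ sum-cong-≗ (λ u → m+[n∸m]≡n (on-triangle u)) ⟩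
    ∑[ u < v ] trianglesAt u                             ≡⟨ ∑-trianglesAt ⟩
    3 * #triangles                                       ∎

-- Distributions on {0, …, 4}

moment : (ℕ → ℕ) → (ℕ → ℕ) → ℕ
moment F n = ∑[ k < 5 ] (n (toℕ k) * F (toℕ k))

moment-point : ∀ (F : ℕ → ℕ) {j} → j ≤ 4 → F j ≡ moment F (λ k → 𝟙 (j ≟ℕ k))
moment-point F {0} _ = sym (trans (+-identityʳ _) (+-identityʳ _))
moment-point F {1} _ = sym (trans (+-identityʳ _) (+-identityʳ _))
moment-point F {2} _ = sym (trans (+-identityʳ _) (+-identityʳ _))
moment-point F {3} _ = sym (trans (+-identityʳ _) (+-identityʳ _))
moment-point F {4} _ = sym (trans (+-identityʳ _) (+-identityʳ _))
moment-point F {suc (suc (suc (suc (suc _))))} (s≤s (s≤s (s≤s (s≤s ()))))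

-- 4 ∸ k and k % 2 have the same parity for k ≤ 4.
moment-parity : ∀ n → moment (4 ∸_) n ≡ 9 → 1 ≤ moment (_% 2) n
moment-parity n M≡9 with moment (_% 2) n in P≡
... | suc _ = s≤s z≤n
... | zero  = contradiction (begin
    2 * (2 * n 0 + 2 * n 1 + n 2 + n 3)            ≡⟨ identity (n 0) (n 1) (n 2) (n 3) (n 4) ⟨
    moment (4 ∸_) n + moment (_% 2) n               ≡⟨ cong₂ _+_ M≡9 P≡ ⟩
    9 + 0                                           ∎) (even≢odd (2 * n 0 + 2 * n 1 + n 2 + n 3) 4)
  where
  identity : ∀ a b c d e → (a * 4 + (b * 3 + (c * 2 + (d * 1 + (e * 0 + 0))))) + (a * 0 + (b * 1 + (c * 0 + (d * 1 + (e * 0 + 0)))))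
                           ≡ 2 * (2 * a + 2 * b + c + d)
  identity = solve-∀

moments-5-9⇒1≤m₃ : ∀ m → m 0 ≡ 0 → m 4 ≡ 0 → moment (λ _ → 1) m ≡ 5 → moment (4 ∸_) m ≡ 9 → 1 ≤ m 3
moments-5-9⇒1≤m₃ m m₀≡0 m₄≡0 M₁≡5 M≡9 = subst (1 ≤_) (sym m₃≡1+m₁) (s≤s z≤n)
  where
  identity : ∀ a b c d e → (a * 4 + (b * 3 + (c * 2 + (d * 1 + (e * 0 + 0))))) + d + 2 * e
                           ≡ 2 * (a * 1 + (b * 1 + (c * 1 + (d * 1 + (e * 1 + 0))))) + 2 * a + b
  identity = solve-∀
  balance : 9 + m 3 + 2 * 0 ≡ 2 * 5 + 2 * 0 + m 1
  balance = begin
    9 + m 3 + 2 * 0                                ≡⟨ cong₂ (λ p q → p + m 3 + 2 * q) M≡9 m₄≡0 ⟨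
    moment (4 ∸_) m + m 3 + 2 * m 4                ≡⟨ identity (m 0) (m 1) (m 2) (m 3) (m 4) ⟩
    2 * moment (λ _ → 1) m + 2 * m 0 + m 1         ≡⟨ cong₂ (λ p q → 2 * p + 2 * q + m 1) M₁≡5 m₀≡0 ⟩
    2 * 5 + 2 * 0 + m 1                            ∎
  m₃≡1+m₁ : m 3 ≡ 1 + m 1
  m₃≡1+m₁ = trans (sym (+-identityʳ (m 3))) (+-cancelˡ-≡ 9 (m 3 + 0) (1 + m 1) balance)

moments-4-8⇒m₁≡m₃ : ∀ m → m 0 ≡ 0 → m 4 ≡ 0 →
                    moment (λ _ → 1) m ≡ 4 → moment (λ j → j) m ≡ 8 → m 1 ≡ m 3
moments-4-8⇒m₁≡m₃ m m₀≡0 m₄≡0 M₁≡4 M≡8 = trans (+-cancelˡ-≡ 8 (m 1) (m 3 + 0) balance) (+-identityʳ (m 3))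
  where
  identity : ∀ a b c d e → (a * 0 + (b * 1 + (c * 2 + (d * 3 + (e * 4 + 0))))) + 2 * a + b
                           ≡ 2 * (a * 1 + (b * 1 + (c * 1 + (d * 1 + (e * 1 + 0))))) + d + 2 * e
  identity = solve-∀
  balance : 8 + 2 * 0 + m 1 ≡ 2 * 4 + m 3 + 2 * 0
  balance = begin
    8 + 2 * 0 + m 1                                ≡⟨ cong₂ (λ p q → p + 2 * q + m 1) M≡8 m₀≡0 ⟨
    moment (λ j → j) m + 2 * m 0 + m 1             ≡⟨ identity (m 0) (m 1) (m 2) (m 3) (m 4) ⟩
    2 * moment (λ _ → 1) m + m 3 + 2 * m 4         ≡⟨ cong₂ (λ p q → 2 * p + m 3 + 2 * q) M₁≡4 m₄≡0 ⟩
    2 * 4 + m 3 + 2 * 0                            ∎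

moments⇒n₀≡0∧n₁≡1∧n₄≡0 : ∀ n → moment (4 ∸_) n ≡ 36 → moment (λ j → j) n ≡ 40 →
                          moment (λ j → j * (4 ∸ j)) n ≡ 72 →
                     8 ≤ moment (λ j → j * (j % 2)) n → n 0 ≡ 0 × n 1 ≡ 1 × n 4 ≡ 0
moments⇒n₀≡0∧n₁≡1∧n₄≡0 n A B C E = forced (n 0) (n 1) (n 4) _ X≡1 E≡ E
  where
  identity₁ : ∀ a b c d e → 6 * (a * 4 + (b * 3 + (c * 2 + (d * 1 + (e * 0 + 0)))))
                             + 2 * (a * 0 + (b * 1 + (c * 2 + (d * 3 + (e * 4 + 0)))))
                           ≡ 4 * (a * 0 + (b * 3 + (c * 4 + (d * 3 + (e * 0 + 0))))) + 8 * (3 * a + b + e)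
  identity₁ = solve-∀
  identity₂ : ∀ a b c d e → 6 * (a * 4 + (b * 3 + (c * 2 + (d * 1 + (e * 0 + 0)))))
                             + (a * 0 + (b * 1 + (c * 0 + (d * 3 + (e * 0 + 0)))))
                           ≡ 3 * (a * 0 + (b * 3 + (c * 4 + (d * 3 + (e * 0 + 0))))) + (24 * a + 10 * b)
  identity₂ = solve-∀
  X≡1 : 3 * n 0 + n 1 + n 4 ≡ 1
  X≡1 = *-cancelˡ-≡ _ 1 8 (+-cancelˡ-≡ 288 _ _ (begin
    4 * 72 + 8 * (3 * n 0 + n 1 + n 4)                        ≡⟨ cong (λ p → 4 * p + 8 * (3 * n 0 + n 1 + n 4)) C ⟨
    4 * moment (λ j → j * (4 ∸ j)) n + 8 * (3 * n 0 + n 1 + n 4) ≡⟨ identity₁ (n 0) (n 1) (n 2) (n 3) (n 4) ⟨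
    6 * moment (4 ∸_) n + 2 * moment (λ j → j) n             ≡⟨ cong₂ (λ p q → 6 * p + 2 * q) A B ⟩
    6 * 36 + 2 * 40                                          ∎))
  E≡ : moment (λ j → j * (j % 2)) n ≡ 24 * n 0 + 10 * n 1
  E≡ = +-cancelˡ-≡ 216 _ _ (begin
    6 * 36 + moment (λ j → j * (j % 2)) n                    ≡⟨ cong (_+ moment (λ j → j * (j % 2)) n) (cong (6 *_) A) ⟨
    6 * moment (4 ∸_) n + moment (λ j → j * (j % 2)) n       ≡⟨ identity₂ (n 0) (n 1) (n 2) (n 3) (n 4) ⟩
    3 * moment (λ j → j * (4 ∸ j)) n + (24 * n 0 + 10 * n 1) ≡⟨ cong (λ p → 3 * p + (24 * n 0 + 10 * n 1)) C ⟩
    3 * 72 + (24 * n 0 + 10 * n 1)                           ∎)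
  forced : ∀ a b e E → 3 * a + b + e ≡ 1 → E ≡ 24 * a + 10 * b → 8 ≤ E → a ≡ 0 × b ≡ 1 × e ≡ 0
  forced zero    zero       (suc zero) _ refl refl ()
  forced zero    (suc zero) zero       _ refl _    _ = refl , refl , refl
  forced (suc a) b          e          _ X≡1  _    _ =
    contradiction (subst (3 ≤_) X≡1 (≤-trans (*-monoʳ-≤ 3 (s≤s z≤n)) (≤-trans (m≤m+n _ b) (m≤m+n _ e))))
                  λ { (s≤s ()) }

-- {K₃, K₄}-decompositions of K_v

module Decomposition {v} (Bs : List (Block v)) (decomposition : IsK34Decomposition v Bs) where

  open Incidence Bs

  ∑-inc-pair : ∀ {u x} → u ≢ x → ∑[ i < #blocks ] (inc u i * inc x i) ≡ 1
  ∑-inc-pair {u} {x} u≢x = begin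
    ∑[ i < #blocks ] (inc u i * inc x i)          ≡⟨ sum-cong-≗ (λ i → 𝟙-×-dec (u ∈ᵇ? i) (x ∈ᵇ? i)) ⟨
    ∑[ i < #blocks ] 𝟙 (u ∈ᵇ? i ×-dec x ∈ᵇ? i)   ≡⟨ length-filter≡∑ _ Bs ⟨
    length (blocksContaining u x Bs)              ≡⟨ decomposition u x u≢x ⟩
    1                                             ∎

  atVertex-common-block : ∀ g {u x i} → u ≢ x → u ∈ᵇ i → x ∈ᵇ i → atVertex (λ j → inc x j * g j) u ≡ g i
  atVertex-common-block g {u} {x} {i} u≢x u∈i x∈i = begin
    atVertex (λ j → inc x j * g j) u              ≡⟨ sum-cong-≗ (λ j → *-assoc (inc u j) (inc x j) (g j)) ⟨
    ∑[ j < #blocks ] (inc u j * inc x j * g j)    ≡⟨ ∑-pick (λ j → inc u j * inc x j) g (∑-inc-pair u≢x) both ⟩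
    g i                                           ∎
    where
    both : inc u i * inc x i ≡ 1
    both = cong₂ _*_ (𝟙-yes (u ∈ᵇ? i) u∈i) (𝟙-yes (x ∈ᵇ? i) x∈i)

  common-block-unique : ∀ {u w i j} → u ≢ w → u ∈ᵇ i → w ∈ᵇ i → u ∈ᵇ j → w ∈ᵇ j → i ≡ j
  common-block-unique {u} {w} {i} {j} u≢w u∈i w∈i u∈j w∈j =
    ∑≤1⇒unique (λ k → inc u k * inc w k) (≤-reflexive (∑-inc-pair u≢w)) (both u∈i w∈i) (both u∈j w∈j)
    where
    both : ∀ {k} → u ∈ᵇ k → w ∈ᵇ k → 0 < inc u k * inc w k
    both {k} u∈k w∈k rewrite 𝟙-yes (u ∈ᵇ? k) u∈k | 𝟙-yes (w ∈ᵇ? k) w∈k = s≤s z≤n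

  ∑-over-blocks-at : ∀ w {x} → w x ≡ 0 → sum w ≡ atVertex (onBlock w) x
  ∑-over-blocks-at w {x} wx≡0 = begin
    sum w                                         ≡⟨ sum-cong-≗ pointwise ⟩
    ∑[ u < v ] (w u * atVertex (inc x) u)         ≡⟨ ∑-atVertex w (inc x) ⟩
    ∑[ i < #blocks ] (onBlock w i * inc x i)      ≡⟨ sum-cong-≗ (λ i → *-comm (onBlock w i) (inc x i)) ⟩
    atVertex (onBlock w) x                        ∎
    where
    pointwise : ∀ u → w u ≡ w u * atVertex (inc x) u
    pointwise u with u ≟ x
    ... | yes refl = trans wx≡0 (sym (cong (_* atVertex (inc x) x) wx≡0))
    ... | no u≢x   = sym (trans (cong (w u *_) (∑-inc-pair u≢x)) (*-identityʳ (w u)))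

  degree : ∀ x → suc (2 * trianglesAt x + 3 * K4sAt x) ≡ v
  degree x = begin
    suc (2 * trianglesAt x + 3 * K4sAt x)
      ≡⟨ cong suc (cong₂ _+_ (atVertex-* 2 isTriangle x) (atVertex-* 3 isK4 x)) ⟨
    suc (atVertex (λ i → 2 * isTriangle i) x + atVertex (λ i → 3 * isK4 i) x)
      ≡⟨ cong suc (atVertex-+ (λ i → 2 * isTriangle i) (λ i → 3 * isK4 i) x) ⟨
    suc (atVertex (λ i → 2 * isTriangle i + 3 * isK4 i) x)
      ≡⟨ cong suc (atVertex-cong x (λ i x∈i → trans (onBlock-≢-through x∈i) (size∸1 i))) ⟨
    suc (atVertex (onBlock (others x)) x)
      ≡⟨ cong suc (∑-over-blocks-at (others x) (others-self x)) ⟨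
    suc (sum (others x))
      ≡⟨ ∑-≢ x ⟩
    v ∎

  edge-count : 6 * (#triangles + 2 * #K4s) + v ≡ v * v
  edge-count = begin
    6 * (#triangles + 2 * #K4s) + v
      ≡⟨ rearrange #triangles #K4s v ⟩
    2 * (3 * #triangles) + 3 * (4 * #K4s) + v * 1
      ≡⟨ cong₂ (λ a b → 2 * a + 3 * b + v * 1) ∑-trianglesAt ∑-K4sAt ⟨
    2 * ∑[ u < v ] trianglesAt u + 3 * ∑[ u < v ] K4sAt u + v * 1
      ≡⟨ cong₂ (λ a b → a + b + v * 1) (*-distribˡ-sum 2 trianglesAt) (*-distribˡ-sum 3 K4sAt) ⟩
    ∑[ u < v ] (2 * trianglesAt u) + ∑[ u < v ] (3 * K4sAt u) + v * 1
      ≡⟨ cong₂ _+_ (∑-distrib-+ (λ u → 2 * trianglesAt u) (λ u → 3 * K4sAt u)) (∑-const v 1) ⟨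
    ∑[ u < v ] (2 * trianglesAt u + 3 * K4sAt u) + ∑[ u < v ] 1
      ≡⟨ ∑-distrib-+ (λ u → 2 * trianglesAt u + 3 * K4sAt u) (λ _ → 1) ⟨
    ∑[ u < v ] (2 * trianglesAt u + 3 * K4sAt u + 1)
      ≡⟨ sum-cong-≗ (λ u → trans (+-comm _ 1) (degree u)) ⟩
    ∑[ u < v ] v
      ≡⟨ ∑-const v v ⟩
    v * v ∎
    where
    rearrange : ∀ t f v → 6 * (t + 2 * f) + v ≡ 2 * (3 * t) + 3 * (4 * f) + v * 1
    rearrange = solve-∀

  module Around (x : Fin v) where

    triangleThrough K4Through triangleAvoiding K4Avoiding : Fin #blocks → ℕ
    triangleThrough  i = inc x i * isTriangle i
    K4Through        i = inc x i * isK4 i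
    triangleAvoiding i = notInc x i * isTriangle i
    K4Avoiding       i = notInc x i * isK4 i

    atVertex-split : ∀ g u →
                     atVertex g u ≡ atVertex (λ i → inc x i * g i) u + atVertex (λ i → notInc x i * g i) u
    atVertex-split g u = trans (sum-cong-≗ pointwise)
      (atVertex-+ (λ i → inc x i * g i) (λ i → notInc x i * g i) u)
      where
      pointwise : ∀ i → inc u i * g i ≡ inc u i * (inc x i * g i + notInc x i * g i)
      pointwise i = cong (inc u i *_) (begin
        g i                                  ≡⟨ *-identityˡ (g i) ⟨
        1 * g i                              ≡⟨ cong (_* g i) (trans (+-comm (inc x i) _) (𝟙-¬? (x ∈ᵇ? i))) ⟨
        (inc x i + notInc x i) * g i         ≡⟨ *-distribʳ-+ (g i) (inc x i) _ ⟩
        inc x i * g i + notInc x i * g i     ∎)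

    triangleThrough+K4Through≡1 : ∀ {u} → u ≢ x → atVertex triangleThrough u + atVertex K4Through u ≡ 1
    triangleThrough+K4Through≡1 {u} u≢x = begin
      atVertex triangleThrough u + atVertex K4Through u             ≡⟨ atVertex-+ triangleThrough K4Through u ⟨
      atVertex (λ i → triangleThrough i + K4Through i) u            ≡⟨ sum-cong-≗ pointwise ⟩
      ∑[ i < #blocks ] (inc u i * inc x i)                           ≡⟨ ∑-inc-pair u≢x ⟩
      1                                                              ∎
      where
      pointwise : ∀ i → inc u i * (triangleThrough i + K4Through i) ≡ inc u i * inc x i
      pointwise i = cong (inc u i *_) (begin
        inc x i * isTriangle i + inc x i * isK4 i   ≡⟨ *-distribˡ-+ (inc x i) (isTriangle i) (isK4 i) ⟨
        inc x i * (isTriangle i + isK4 i)           ≡⟨ cong (inc x i *_) (isTriangle+isK4≡1 i) ⟩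
        inc x i * 1                                 ≡⟨ *-identityʳ (inc x i) ⟩
        inc x i                                     ∎)

    -- For u ≠ x exactly one of these is 1, according as the unique block through u and x
    -- is a triangle or a K₄; both vanish at x.
    triangleMate K4Mate : Fin v → ℕ
    triangleMate u = others x u * atVertex triangleThrough u
    K4Mate       u = others x u * atVertex K4Through u

    #triangleMates #K4Mates : Fin #blocks → ℕ
    #triangleMates = onBlock triangleMate
    #K4Mates       = onBlock K4Mate

    triangleMate+K4Mate : ∀ u → triangleMate u + K4Mate u ≡ others x u
    triangleMate+K4Mate u with u ≟ x
    ... | yes _   = refl
    ... | no u≢x  = trans (cong₂ _+_ (*-identityˡ (atVertex triangleThrough u)) (*-identityˡ (atVertex K4Through u)))
                          (triangleThrough+K4Through≡1 u≢x)

    triangleMate-x : triangleMate x ≡ 0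
    triangleMate-x = cong (_* atVertex triangleThrough x) (others-self x)

    K4Mate-x : K4Mate x ≡ 0
    K4Mate-x = cong (_* atVertex K4Through x) (others-self x)

    #mates-through : ∀ {i} → x ∈ᵇ i → #triangleMates i ≡ 2 * isTriangle i × #K4Mates i ≡ 3 * isK4 i
    #mates-through {i} x∈i = count isTriangle 2 (*-isTriangle (_∸ 1) i) , count isK4 3 (*-isK4 (_∸ 1) i)
      where
      mate-in-block : ∀ g u → u ∈ᵇ i → others x u * atVertex (λ j → inc x j * g j) u ≡ others x u * g i
      mate-in-block g u u∈i with u ≟ x
      ... | yes _   = refl
      ... | no u≢x  = cong (1 *_) (atVertex-common-block g u≢x u∈i x∈i)
      count : ∀ g c → (size i ∸ 1) * g i ≡ c * g i →
              onBlock (λ u → others x u * atVertex (λ j → inc x j * g j) u) i ≡ c * g i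
      count g c eq = begin
        onBlock (λ u → others x u * atVertex (λ j → inc x j * g j) u) i ≡⟨ onBlock-cong i (mate-in-block g) ⟩
        onBlock (λ u → others x u * g i) i                             ≡⟨ onBlock-*ʳ (others x) (g i) i ⟩
        onBlock (others x) i * g i                                     ≡⟨ cong (_* g i) (onBlock-≢-through x∈i) ⟩
        (size i ∸ 1) * g i                                             ≡⟨ eq ⟩
        c * g i                                                        ∎

    triangleMate-spec : ∀ {u} → triangleMate u ≢ 0 →
                        u ≢ x × atVertex triangleThrough u ≡ 1 × atVertex K4Through u ≡ 0
    triangleMate-spec {u} mate with u ≟ x
    ... | yes _   = contradiction refl mate
    ... | no u≢x  with m+n≡1⇒ (triangleThrough+K4Through≡1 u≢x)
    ...   | inj₁ (t≡1 , k≡0) = u≢x , t≡1 , k≡0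
    ...   | inj₂ (t≡0 , _)   = contradiction (cong (1 *_) t≡0) mate

    K4Mate-spec : ∀ {u} → K4Mate u ≢ 0 →
                  u ≢ x × atVertex triangleThrough u ≡ 0 × atVertex K4Through u ≡ 1
    K4Mate-spec {u} mate with u ≟ x
    ... | yes _   = contradiction refl mate
    ... | no u≢x  with m+n≡1⇒ (triangleThrough+K4Through≡1 u≢x)
    ...   | inj₁ (_ , k≡0)   = contradiction (cong (1 *_) k≡0) mate
    ...   | inj₂ (t≡0 , k≡1) = u≢x , t≡0 , k≡1

    ∑-triangleMate : sum triangleMate ≡ 2 * trianglesAt x
    ∑-triangleMate = begin
      sum triangleMate                         ≡⟨ ∑-over-blocks-at triangleMate triangleMate-x ⟩
      atVertex #triangleMates x                ≡⟨ atVertex-cong x (λ i x∈i → proj₁ (#mates-through x∈i)) ⟩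
      atVertex (λ i → 2 * isTriangle i) x      ≡⟨ atVertex-* 2 isTriangle x ⟩
      2 * trianglesAt x                        ∎

    ∑-K4Mate : sum K4Mate ≡ 3 * K4sAt x
    ∑-K4Mate = begin
      sum K4Mate                               ≡⟨ ∑-over-blocks-at K4Mate K4Mate-x ⟩
      atVertex #K4Mates x                      ≡⟨ atVertex-cong x (λ i x∈i → proj₂ (#mates-through x∈i)) ⟩
      atVertex (λ i → 3 * isK4 i) x            ≡⟨ atVertex-* 3 isK4 x ⟩
      3 * K4sAt x                              ∎

    #mates-avoiding : ∀ {i} → ¬ x ∈ᵇ i → #triangleMates i + #K4Mates i ≡ size i
    #mates-avoiding {i} x∉i = begin
      #triangleMates i + #K4Mates i                   ≡⟨ onBlock-+ triangleMate K4Mate i ⟨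
      onBlock (λ u → triangleMate u + K4Mate u) i     ≡⟨ onBlock-cong i (λ u _ → triangleMate+K4Mate u) ⟩
      onBlock (others x) i                            ≡⟨ +-identityʳ _ ⟨
      onBlock (others x) i + 0                        ≡⟨ cong (onBlock (others x) i +_) (𝟙-no (x ∈ᵇ? i) x∉i) ⟨
      onBlock (others x) i + inc x i                  ≡⟨ onBlock-≢ x i ⟩
      size i                                          ∎

    K4Avoiding≡1 : ∀ {i} → ¬ x ∈ᵇ i → size i ≡ 4 → K4Avoiding i ≡ 1
    K4Avoiding≡1 {i} x∉i size≡4 = cong₂ _*_ (𝟙-yes (¬? (x ∈ᵇ? i)) x∉i) (𝟙-yes (size i ≟ℕ 4) size≡4)

    data Position (i : Fin #blocks) : Set where
      through          : x ∈ᵇ i → K4Avoiding i ≡ 0 → Position i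
      avoidingTriangle : triangleAvoiding i ≡ 1 → K4Avoiding i ≡ 0 → Position i
      avoidingK4       : ¬ x ∈ᵇ i → size i ≡ 4 → K4Avoiding i ≡ 1 → Position i

    position : ∀ i → Position i
    position i with x ∈ᵇ? i | size34 (blockAt i)
    ... | yes x∈i | _           = through x∈i (cong (_* isK4 i) (𝟙-no (¬? (x ∈ᵇ? i)) λ x∉i → x∉i x∈i))
    ... | no x∉i  | inj₂ size≡4 = avoidingK4 x∉i size≡4 (K4Avoiding≡1 x∉i size≡4)
    ... | no x∉i  | inj₁ size≡3 = avoidingTriangle (cong₂ _*_ x∉i⇒1 (𝟙-yes (size i ≟ℕ 3) size≡3))
                                                   (cong₂ _*_ x∉i⇒1 (𝟙-no (size i ≟ℕ 4) (3≢4 ∘ trans (sym size≡3))))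
      where
      x∉i⇒1 : notInc x i ≡ 1
      x∉i⇒1 = 𝟙-yes (¬? (x ∈ᵇ? i)) x∉i
      3≢4 : 3 ≢ 4
      3≢4 ()

    -- A K₄ avoiding x consists of four mates of x, so it is classified by its number
    -- k ∈ {0, …, 4} of triangle mates; profile g is the g-weighted distribution of k.
    avoidingK4Sum : (Fin #blocks → ℕ) → (ℕ → ℕ) → ℕ
    avoidingK4Sum g F = ∑[ i < #blocks ] (g i * (K4Avoiding i * F (#triangleMates i)))

    avoidingK4With : ℕ → Fin #blocks → ℕ
    avoidingK4With k i = K4Avoiding i * 𝟙 (#triangleMates i ≟ℕ k)

    profile : (Fin #blocks → ℕ) → ℕ → ℕ
    profile g k = ∑[ i < #blocks ] (g i * avoidingK4With k i)

    avoidingK4Sum-cong : ∀ {g g′ F F′} →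
      (∀ i → ¬ x ∈ᵇ i → size i ≡ 4 → g i * F (#triangleMates i) ≡ g′ i * F′ (#triangleMates i)) →
      avoidingK4Sum g F ≡ avoidingK4Sum g′ F′
    avoidingK4Sum-cong {g} {g′} {F} {F′} eq = sum-cong-≗ pointwise
      where
      pointwise : ∀ i → g i * (K4Avoiding i * F (#triangleMates i)) ≡ g′ i * (K4Avoiding i * F′ (#triangleMates i))
      pointwise i with position i
      ... | through _ K≡0            rewrite K≡0 = trans (*-zeroʳ (g i)) (sym (*-zeroʳ (g′ i)))
      ... | avoidingTriangle _ K≡0   rewrite K≡0 = trans (*-zeroʳ (g i)) (sym (*-zeroʳ (g′ i)))
      ... | avoidingK4 x∉i size≡4 K≡1 rewrite K≡1 =
        trans (cong (g i *_) (*-identityˡ _)) (trans (eq i x∉i size≡4) (cong (g′ i *_) (sym (*-identityˡ _))))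

    #K4Mates-avoiding : ∀ {i} → ¬ x ∈ᵇ i → size i ≡ 4 → #K4Mates i ≡ 4 ∸ #triangleMates i
    #K4Mates-avoiding {i} x∉i size≡4 =
      trans (sym (m+n∸m≡n (#triangleMates i) (#K4Mates i))) (cong (_∸ #triangleMates i) (trans (#mates-avoiding x∉i) size≡4))

    #triangleMates≤4 : ∀ {i} → ¬ x ∈ᵇ i → size i ≡ 4 → #triangleMates i ≤ 4
    #triangleMates≤4 {i} x∉i size≡4 = subst (#triangleMates i ≤_) (trans (#mates-avoiding x∉i) size≡4) (m≤m+n _ _)

    avoidingK4Sum≡moment : ∀ g F → avoidingK4Sum g F ≡ moment F (profile g)
    avoidingK4Sum≡moment g F = begin
      ∑[ i < #blocks ] (g i * (K4Avoiding i * F (#triangleMates i)))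
        ≡⟨ sum-cong-≗ (λ i → cong (g i *_) (split i)) ⟩
      ∑[ i < #blocks ] (g i * ∑[ k < 5 ] (δ i k * F (toℕ k)))
        ≡⟨ sum-cong-≗ (λ i → *-distribˡ-sum (g i) (λ k → δ i k * F (toℕ k))) ⟩
      ∑[ i < #blocks ] ∑[ k < 5 ] (g i * (δ i k * F (toℕ k)))
        ≡⟨ sum-cong-≗ (λ i → sum-cong-≗ (λ k → *-assoc (g i) (δ i k) (F (toℕ k)))) ⟨
      ∑[ i < #blocks ] ∑[ k < 5 ] (g i * δ i k * F (toℕ k))
        ≡⟨ ∑-comm (λ i k → g i * δ i k * F (toℕ k)) ⟩
      ∑[ k < 5 ] ∑[ i < #blocks ] (g i * δ i k * F (toℕ k))
        ≡⟨ sum-cong-≗ (λ k → *-distribʳ-sum (F (toℕ k)) (λ i → g i * δ i k)) ⟨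
      moment F (profile g)
        ∎
      where
      δ : Fin #blocks → Fin 5 → ℕ
      δ i k = K4Avoiding i * 𝟙 (#triangleMates i ≟ℕ toℕ k)
      split : ∀ i → K4Avoiding i * F (#triangleMates i) ≡ ∑[ k < 5 ] (δ i k * F (toℕ k))
      split i with position i
      ... | through _ K≡0            rewrite K≡0 = refl
      ... | avoidingTriangle _ K≡0   rewrite K≡0 = refl
      ... | avoidingK4 x∉i size≡4 K≡1 rewrite K≡1 = begin
        1 * F (#triangleMates i)                                     ≡⟨ *-identityˡ (F (#triangleMates i)) ⟩
        F (#triangleMates i)                                         ≡⟨ moment-point F (#triangleMates≤4 x∉i size≡4) ⟩
        ∑[ k < 5 ] (𝟙 (#triangleMates i ≟ℕ toℕ k) * F (toℕ k))
          ≡⟨ sum-cong-≗ {5} (λ k → cong (_* F (toℕ k)) (*-identityˡ (𝟙 (#triangleMates i ≟ℕ toℕ k)))) ⟨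
        ∑[ k < 5 ] (1 * 𝟙 (#triangleMates i ≟ℕ toℕ k) * F (toℕ k))    ∎

    ∑-avoidingK4Sum : ∀ w F → ∑[ u < v ] (w u * avoidingK4Sum (inc u) F) ≡ avoidingK4Sum (onBlock w) F
    ∑-avoidingK4Sum w F = ∑-atVertex w (λ i → K4Avoiding i * F (#triangleMates i))

    avoidingK4With≡1 : ∀ {k i} → ¬ x ∈ᵇ i → size i ≡ 4 → #triangleMates i ≡ k → avoidingK4With k i ≡ 1
    avoidingK4With≡1 {k} {i} x∉i size≡4 tm≡k =
      cong₂ _*_ (K4Avoiding≡1 x∉i size≡4) (𝟙-yes (#triangleMates i ≟ℕ k) tm≡k)

    avoidingK4With-spec : ∀ {k i} → 0 < avoidingK4With k i → ¬ x ∈ᵇ i × size i ≡ 4 × #triangleMates i ≡ k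
    avoidingK4With-spec {k} {i} 0<δ with 0<m*n⇒0<m×0<n {K4Avoiding i} 0<δ | position i
    ... | 0<K , _   | through _ K≡0           = contradiction (subst (0 <_) K≡0 0<K) λ ()
    ... | 0<K , _   | avoidingTriangle _ K≡0  = contradiction (subst (0 <_) K≡0 0<K) λ ()
    ... | _ , 0<𝟙   | avoidingK4 x∉i size≡4 _ = x∉i , size≡4 , 𝟙-pos (#triangleMates i ≟ℕ k) 0<𝟙

    profile-pos⇒∃ : ∀ g k → 0 < profile g k → ∃[ i ] (0 < g i × ¬ x ∈ᵇ i × size i ≡ 4 × #triangleMates i ≡ k)
    profile-pos⇒∃ g k 0<p with ∑-pos⇒∃ (λ i → g i * avoidingK4With k i) 0<p
    ... | i , 0<term with 0<m*n⇒0<m×0<n {g i} 0<term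
    ...   | 0<g , 0<δ = i , 0<g , avoidingK4With-spec 0<δ

    profile-pos : ∀ {u i k} → u ∈ᵇ i → ¬ x ∈ᵇ i → size i ≡ 4 → #triangleMates i ≡ k → 0 < profile (inc u) k
    profile-pos {u} {i} {k} u∈i x∉i size≡4 tm≡k =
      ≤-trans (≤-reflexive (sym (cong₂ _*_ (𝟙-yes (u ∈ᵇ? i) u∈i) (avoidingK4With≡1 x∉i size≡4 tm≡k))))
              (≤-∑ (λ j → inc u j * avoidingK4With k j) i)

    profile-≤ : ∀ u k → profile (inc u) k ≤ profile (λ _ → 1) k
    profile-≤ u k = ∑-mono-≤ (λ i → *-monoˡ-≤ (avoidingK4With k i) (𝟙≤1 (u ∈ᵇ? i)))

    -- The configuration forced by seven triangles; it is contradictory.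
    module Exceptional
      (x-triangles : trianglesAt x ≡ 4) (x-K4s : K4sAt x ≡ 3)
      (ordinary : ∀ u → u ≢ x → trianglesAt u ≡ 1 × K4sAt u ≡ 5) where

      triangleMate-degrees : ∀ {z} → triangleMate z ≢ 0 →
                             atVertex triangleAvoiding z ≡ 0 × atVertex K4Avoiding z ≡ 5
      triangleMate-degrees {z} mate with triangleMate-spec mate
      ... | z≢x , T≡1 , K≡0 = +-cancelˡ-≡ 1 _ 0 triangles , K4s
        where
        triangles : 1 + atVertex triangleAvoiding z ≡ 1
        triangles = subst (λ t → t + atVertex triangleAvoiding z ≡ 1) T≡1
                          (trans (sym (atVertex-split isTriangle z)) (proj₁ (ordinary z z≢x)))
        K4s : 0 + atVertex K4Avoiding z ≡ 5
        K4s = subst (λ k → k + atVertex K4Avoiding z ≡ 5) K≡0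
                    (trans (sym (atVertex-split isK4 z)) (proj₂ (ordinary z z≢x)))

      K4Mate-degrees : ∀ {y} → K4Mate y ≢ 0 → atVertex triangleAvoiding y ≡ 1 × atVertex K4Avoiding y ≡ 4
      K4Mate-degrees {y} mate with K4Mate-spec mate
      ... | y≢x , T≡0 , K≡1 = triangles , +-cancelˡ-≡ 1 _ 4 K4s
        where
        triangles : 0 + atVertex triangleAvoiding y ≡ 1
        triangles = subst (λ t → t + atVertex triangleAvoiding y ≡ 1) T≡0
                          (trans (sym (atVertex-split isTriangle y)) (proj₁ (ordinary y y≢x)))
        K4s : 1 + atVertex K4Avoiding y ≡ 5
        K4s = subst (λ k → k + atVertex K4Avoiding y ≡ 5) K≡1
                    (trans (sym (atVertex-split isK4 y)) (proj₂ (ordinary y y≢x)))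

      no-triangleMates-on-triangleAvoiding : ∀ {i} → triangleAvoiding i ≡ 1 → #triangleMates i ≡ 0
      no-triangleMates-on-triangleAvoiding {i} T≡1 = begin
        onBlock triangleMate i          ≡⟨ onBlock-cong i none ⟩
        onBlock (λ _ → 0) i             ≡⟨ sum-cong-≗ (λ u → *-zeroʳ (inc u i)) ⟩
        ∑[ u < v ] 0                    ≡⟨ sum-replicate-zero v ⟩
        0                               ∎
        where
        none : ∀ u → u ∈ᵇ i → triangleMate u ≡ 0
        none u u∈i with triangleMate u ≟ℕ 0
        ... | yes tm≡0 = tm≡0
        ... | no mate  = contradiction (trans (sym T≡1) (atVertex≡0 triangleAvoiding (proj₁ (triangleMate-degrees mate)) u∈i)) λ ()

      -- A triangle mate lies only on its triangle with x, which holds no K₄ mate, and on K₄s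
      -- avoiding x; a K₄ mate lies on its K₄ with x and on one triangle avoiding x, neither of
      -- which holds a triangle mate.
      K4Mates-beside-triangleMate : ∀ {z i} → triangleMate z ≢ 0 → z ∈ᵇ i →
                                    #K4Mates i ≡ K4Avoiding i * (4 ∸ #triangleMates i)
      K4Mates-beside-triangleMate {z} {i} mate z∈i with triangleMate-spec mate | position i
      ... | z≢x , _ , K≡0 | through x∈i K4Av≡0 rewrite K4Av≡0 =
        trans (proj₂ (#mates-through x∈i)) (cong (3 *_) (trans (sym (atVertex-common-block isK4 z≢x z∈i x∈i)) K≡0))
      ... | _ | avoidingTriangle T≡1 _ =
        contradiction (trans (sym T≡1) (atVertex≡0 triangleAvoiding (proj₁ (triangleMate-degrees mate)) z∈i)) λ ()
      ... | _ | avoidingK4 x∉i size≡4 K4Av≡1 rewrite K4Av≡1 =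
        trans (#K4Mates-avoiding x∉i size≡4) (sym (*-identityˡ _))

      triangleMates-beside-K4Mate : ∀ {y i} → K4Mate y ≢ 0 → y ∈ᵇ i →
                                    #triangleMates i ≡ K4Avoiding i * #triangleMates i
      triangleMates-beside-K4Mate {y} {i} mate y∈i with K4Mate-spec mate | position i
      ... | y≢x , T≡0 , _ | through x∈i K4Av≡0 rewrite K4Av≡0 =
        trans (proj₁ (#mates-through x∈i)) (cong (2 *_) (trans (sym (atVertex-common-block isTriangle y≢x y∈i x∈i)) T≡0))
      ... | _ | avoidingTriangle T≡1 K4Av≡0 rewrite K4Av≡0 =
        no-triangleMates-on-triangleAvoiding T≡1
      ... | _ | avoidingK4 _ _ K4Av≡1 rewrite K4Av≡1 = sym (*-identityˡ _)

      #avoidingK4s : ∀ u → avoidingK4Sum (inc u) (λ _ → 1) ≡ atVertex K4Avoiding u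
      #avoidingK4s u = sum-cong-≗ (λ i → cong (inc u i *_) (*-identityʳ (K4Avoiding i)))

      triangleMate-sees-K4Mates : ∀ {z} → triangleMate z ≢ 0 → avoidingK4Sum (inc z) (4 ∸_) ≡ 9
      triangleMate-sees-K4Mates {z} mate = begin
        avoidingK4Sum (inc z) (4 ∸_)   ≡⟨ atVertex-cong z (λ i z∈i → K4Mates-beside-triangleMate mate z∈i) ⟨
        atVertex #K4Mates z            ≡⟨ ∑-over-blocks-at K4Mate K4Mate-z ⟨
        sum K4Mate                     ≡⟨ ∑-K4Mate ⟩
        3 * K4sAt x                    ≡⟨ cong (3 *_) x-K4s ⟩
        9                              ∎
        where
        K4Mate-z : K4Mate z ≡ 0
        K4Mate-z = trans (cong (others x z *_) (proj₂ (proj₂ (triangleMate-spec mate)))) (*-zeroʳ (others x z))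

      K4Mate-sees-triangleMates : ∀ {y} → K4Mate y ≢ 0 → avoidingK4Sum (inc y) (λ j → j) ≡ 8
      K4Mate-sees-triangleMates {y} mate = begin
        avoidingK4Sum (inc y) (λ j → j) ≡⟨ atVertex-cong y (λ i y∈i → triangleMates-beside-K4Mate mate y∈i) ⟨
        atVertex #triangleMates y       ≡⟨ ∑-over-blocks-at triangleMate triangleMate-y ⟨
        sum triangleMate                ≡⟨ ∑-triangleMate ⟩
        2 * trianglesAt x               ≡⟨ cong (2 *_) x-triangles ⟩
        8                               ∎
        where
        triangleMate-y : triangleMate y ≡ 0
        triangleMate-y = trans (cong (others x y *_) (proj₁ (proj₂ (K4Mate-spec mate)))) (*-zeroʳ (others x y))

      ∑-over-mates : ∀ w F c → (∀ u → w u ≢ 0 → avoidingK4Sum (inc u) F ≡ c) → avoidingK4Sum (onBlock w) F ≡ sum w * c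
      ∑-over-mates w F c constant = begin
        avoidingK4Sum (onBlock w) F                      ≡⟨ ∑-avoidingK4Sum w F ⟨
        ∑[ u < v ] (w u * avoidingK4Sum (inc u) F)       ≡⟨ ∑-*-cong w constant ⟩
        ∑[ u < v ] (w u * c)                             ≡⟨ *-distribʳ-sum c w ⟨
        sum w * c                                        ∎

      #avoidingK4With : ℕ → ℕ
      #avoidingK4With = profile (λ _ → 1)

      moment-K4Mates : moment (4 ∸_) #avoidingK4With ≡ 36
      moment-K4Mates = begin
        moment (4 ∸_) #avoidingK4With          ≡⟨ avoidingK4Sum≡moment (λ _ → 1) (4 ∸_) ⟨
        avoidingK4Sum (λ _ → 1) (4 ∸_)
          ≡⟨ avoidingK4Sum-cong {λ _ → 1} {#K4Mates} {4 ∸_} {λ _ → 1} (λ i x∉i size≡4 →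
               trans (*-identityˡ (4 ∸ #triangleMates i))
                     (trans (sym (#K4Mates-avoiding x∉i size≡4)) (sym (*-identityʳ (#K4Mates i))))) ⟩
        avoidingK4Sum #K4Mates (λ _ → 1)
          ≡⟨ ∑-over-mates K4Mate (λ _ → 1) 4 (λ u mate → trans (#avoidingK4s u) (proj₂ (K4Mate-degrees mate))) ⟩
        sum K4Mate * 4                         ≡⟨ cong (_* 4) (trans ∑-K4Mate (cong (3 *_) x-K4s)) ⟩
        36                                     ∎

      moment-triangleMates : moment (λ j → j) #avoidingK4With ≡ 40
      moment-triangleMates = begin
        moment (λ j → j) #avoidingK4With       ≡⟨ avoidingK4Sum≡moment (λ _ → 1) (λ j → j) ⟨
        avoidingK4Sum (λ _ → 1) (λ j → j)
          ≡⟨ avoidingK4Sum-cong {λ _ → 1} {#triangleMates} {λ j → j} {λ _ → 1} (λ i _ _ → *-comm 1 (#triangleMates i)) ⟩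
        avoidingK4Sum #triangleMates (λ _ → 1)
          ≡⟨ ∑-over-mates triangleMate (λ _ → 1) 5 (λ u mate → trans (#avoidingK4s u) (proj₂ (triangleMate-degrees mate))) ⟩
        sum triangleMate * 5                   ≡⟨ cong (_* 5) (trans ∑-triangleMate (cong (2 *_) x-triangles)) ⟩
        40                                     ∎

      moment-mixed-edges : moment (λ j → j * (4 ∸ j)) #avoidingK4With ≡ 72
      moment-mixed-edges = begin
        moment (λ j → j * (4 ∸ j)) #avoidingK4With ≡⟨ avoidingK4Sum≡moment (λ _ → 1) (λ j → j * (4 ∸ j)) ⟨
        avoidingK4Sum (λ _ → 1) (λ j → j * (4 ∸ j))
          ≡⟨ avoidingK4Sum-cong {λ _ → 1} {#K4Mates} {λ j → j * (4 ∸ j)} {λ j → j} (λ i x∉i size≡4 →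
               trans (*-identityˡ (#triangleMates i * (4 ∸ #triangleMates i)))
                     (trans (*-comm (#triangleMates i) (4 ∸ #triangleMates i))
                            (cong (_* #triangleMates i) (sym (#K4Mates-avoiding x∉i size≡4))))) ⟩
        avoidingK4Sum #K4Mates (λ j → j)
          ≡⟨ ∑-over-mates K4Mate (λ j → j) 8 (λ _ → K4Mate-sees-triangleMates) ⟩
        sum K4Mate * 8                         ≡⟨ cong (_* 8) (trans ∑-K4Mate (cong (3 *_) x-K4s)) ⟩
        72                                     ∎

      moment-odd : 8 ≤ moment (λ j → j * (j % 2)) #avoidingK4With
      moment-odd = ≤-trans (≤-reflexive (sym lower)) (≤-trans (∑-*-mono-≤ triangleMate odd) (≤-reflexive upper))
        where
        lower : ∑[ u < v ] (triangleMate u * 1) ≡ 8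
        lower = trans (sym (*-distribʳ-sum 1 triangleMate)) (cong (_* 1) (trans ∑-triangleMate (cong (2 *_) x-triangles)))
        odd : ∀ u → triangleMate u ≢ 0 → 1 ≤ avoidingK4Sum (inc u) (_% 2)
        odd u mate = subst (1 ≤_) (sym (avoidingK4Sum≡moment (inc u) (_% 2)))
          (moment-parity (profile (inc u)) (trans (sym (avoidingK4Sum≡moment (inc u) (4 ∸_))) (triangleMate-sees-K4Mates mate)))
        upper : ∑[ u < v ] (triangleMate u * avoidingK4Sum (inc u) (_% 2)) ≡ moment (λ j → j * (j % 2)) #avoidingK4With
        upper = begin
          ∑[ u < v ] (triangleMate u * avoidingK4Sum (inc u) (_% 2)) ≡⟨ ∑-avoidingK4Sum triangleMate (_% 2) ⟩
          avoidingK4Sum #triangleMates (_% 2)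
            ≡⟨ avoidingK4Sum-cong {#triangleMates} {λ _ → 1} {_% 2} {λ j → j * (j % 2)} (λ i _ _ → sym (*-identityˡ _)) ⟩
          avoidingK4Sum (λ _ → 1) (λ j → j * (j % 2))
            ≡⟨ avoidingK4Sum≡moment (λ _ → 1) (λ j → j * (j % 2)) ⟩
          moment (λ j → j * (j % 2)) #avoidingK4With                 ∎

      #avoidingK4With-values : #avoidingK4With 0 ≡ 0 × #avoidingK4With 1 ≡ 1 × #avoidingK4With 4 ≡ 0
      #avoidingK4With-values =
        moments⇒n₀≡0∧n₁≡1∧n₄≡0 #avoidingK4With moment-K4Mates moment-triangleMates moment-mixed-edges moment-odd

      profile-vanishes : ∀ u {k} → #avoidingK4With k ≡ 0 → profile (inc u) k ≡ 0
      profile-vanishes u {k} nk≡0 = n≤0⇒n≡0 (subst (profile (inc u) k ≤_) nk≡0 (profile-≤ u k))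

      triangleMate-on-3 : ∀ {z} → triangleMate z ≢ 0 → 0 < profile (inc z) 3
      triangleMate-on-3 {z} mate =
        moments-5-9⇒1≤m₃ (profile (inc z))
          (profile-vanishes z (proj₁ #avoidingK4With-values)) (profile-vanishes z (proj₂ (proj₂ #avoidingK4With-values)))
          (trans (sym (avoidingK4Sum≡moment (inc z) (λ _ → 1))) (trans (#avoidingK4s z) (proj₂ (triangleMate-degrees mate))))
          (trans (sym (avoidingK4Sum≡moment (inc z) (4 ∸_))) (triangleMate-sees-K4Mates mate))

      K4Mate-balanced : ∀ {y} → K4Mate y ≢ 0 → profile (inc y) 1 ≡ profile (inc y) 3
      K4Mate-balanced {y} mate =
        moments-4-8⇒m₁≡m₃ (profile (inc y))
          (profile-vanishes y (proj₁ #avoidingK4With-values)) (profile-vanishes y (proj₂ (proj₂ #avoidingK4With-values)))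
          (trans (sym (avoidingK4Sum≡moment (inc y) (λ _ → 1))) (trans (#avoidingK4s y) (proj₂ (K4Mate-degrees mate))))
          (trans (sym (avoidingK4Sum≡moment (inc y) (λ j → j))) (K4Mate-sees-triangleMates mate))

      unique-block-with-one-triangleMate : ∀ {i j} → ¬ x ∈ᵇ i → size i ≡ 4 → #triangleMates i ≡ 1 →
                                                      ¬ x ∈ᵇ j → size j ≡ 4 → #triangleMates j ≡ 1 → i ≡ j
      unique-block-with-one-triangleMate x∉i size-i one-i x∉j size-j one-j =
        ∑≤1⇒unique (λ k → 1 * avoidingK4With 1 k) (≤-reflexive (proj₁ (proj₂ #avoidingK4With-values)))
          (≡1⇒0< (trans (*-identityˡ _) (avoidingK4With≡1 x∉i size-i one-i)))
          (≡1⇒0< (trans (*-identityˡ _) (avoidingK4With≡1 x∉j size-j one-j)))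

      impossible : ⊥
      impossible =
        let B , _ , x∉B , size-B , one-B          = profile-pos⇒∃ (λ _ → 1) 1 (≡1⇒0< n₁≡1)
            z , z∈B , z-mate                      = onBlock-pos⇒∃ triangleMate (≡1⇒0< one-B)
            C , z-in-C , x∉C , size-C , three-C   = profile-pos⇒∃ (inc z) 3 (triangleMate-on-3 (>⇒≢ z-mate))
            one-K4Mate                            = trans (#K4Mates-avoiding x∉C size-C) (cong (4 ∸_) three-C)
            y , y∈C , y-mate                      = onBlock-pos⇒∃ K4Mate (≡1⇒0< one-K4Mate)
            y-on-1                                = subst (0 <_) (sym (K4Mate-balanced (>⇒≢ y-mate)))
                                                          (profile-pos y∈C x∉C size-C three-C)
            B′ , y-in-B′ , x∉B′ , size-B′ , one-B′ = profile-pos⇒∃ (inc y) 1 y-on-1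
            B′≡B = unique-block-with-one-triangleMate x∉B′ size-B′ one-B′ x∉B size-B one-B
            y∈B  = subst (y ∈ᵇ_) B′≡B (𝟙-pos (y ∈ᵇ? B′) y-in-B′)
            B≡C  = common-block-unique (mates-differ (>⇒≢ z-mate) (>⇒≢ y-mate)) z∈B y∈B (𝟙-pos (z ∈ᵇ? C) z-in-C) y∈C
        in contradiction (trans (sym one-B) (trans (cong #triangleMates B≡C) three-C)) λ ()
        where
        n₁≡1 : #avoidingK4With 1 ≡ 1
        n₁≡1 = proj₁ (proj₂ #avoidingK4With-values)
        mates-differ : ∀ {z y} → triangleMate z ≢ 0 → K4Mate y ≢ 0 → z ≢ y
        mates-differ {z} z-mate y-mate refl =
          contradiction (trans (sym (proj₁ (proj₂ (triangleMate-spec {z} z-mate)))) (proj₁ (proj₂ (K4Mate-spec {z} y-mate)))) λ ()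

-- {K₃, K₄}-decompositions of K₁₈

2a+3b≡17⇒ : ∀ a b → 2 * a + 3 * b ≡ 17 → (a ≡ 1 × b ≡ 5) ⊎ (a ≡ 4 × b ≡ 3) ⊎ (a ≡ 7 × b ≡ 1)
2a+3b≡17⇒ a 0 eq = contradiction (trans (sym (+-identityʳ (2 * a))) eq) (even≢odd a 8)
2a+3b≡17⇒ a 1 eq = inj₂ (inj₂ (*-cancelˡ-≡ a 7 2 (+-cancelʳ-≡ 3 (2 * a) 14 eq) , refl))
2a+3b≡17⇒ a 2 eq = contradiction (+-cancelʳ-≡ 6 (2 * a) 11 eq) (even≢odd a 5)
2a+3b≡17⇒ a 3 eq = inj₂ (inj₁ (*-cancelˡ-≡ a 4 2 (+-cancelʳ-≡ 9 (2 * a) 8 eq) , refl))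
2a+3b≡17⇒ a 4 eq = contradiction (+-cancelʳ-≡ 12 (2 * a) 5 eq) (even≢odd a 2)
2a+3b≡17⇒ a 5 eq = inj₁ (*-cancelˡ-≡ a 1 2 (+-cancelʳ-≡ 15 (2 * a) 2 eq) , refl)
2a+3b≡17⇒ a b@(suc (suc (suc (suc (suc (suc _)))))) eq =
  contradiction (subst (18 ≤_) eq (≤-trans (*-monoʳ-≤ 3 6≤b) (m≤n+m (3 * b) (2 * a)))) (n≮n 17)
  where
  6≤b : 6 ≤ b
  6≤b = s≤s (s≤s (s≤s (s≤s (s≤s (s≤s z≤n)))))

2a+3b≡17⇒1≤a : ∀ {a b} → 2 * a + 3 * b ≡ 17 → 1 ≤ a
2a+3b≡17⇒1≤a {a} {b} eq with 2a+3b≡17⇒ a b eq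
... | inj₁ (refl , refl)        = s≤s z≤n
... | inj₂ (inj₁ (refl , refl)) = s≤s z≤n
... | inj₂ (inj₂ (refl , refl)) = s≤s z≤n

2a+3b≡17⇒a≡4 : ∀ {a b} → 2 * a + 3 * b ≡ 17 → 1 ≤ a ∸ 1 → a ∸ 1 ≤ 3 → a ≡ 4 × b ≡ 3
2a+3b≡17⇒a≡4 {a} {b} eq 1≤a∸1 a∸1≤3 with 2a+3b≡17⇒ a b eq
... | inj₂ (inj₁ (refl , refl)) = refl , refl
2a+3b≡17⇒a≡4 {a} {b} eq () _ | inj₁ (refl , refl)
2a+3b≡17⇒a≡4 {a} {b} eq _ (s≤s (s≤s (s≤s ()))) | inj₂ (inj₂ (refl , refl))

2a+3b≡17⇒a≡1 : ∀ {a b} → 2 * a + 3 * b ≡ 17 → a ∸ 1 ≤ 2 → a ≡ 1 × b ≡ 5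
2a+3b≡17⇒a≡1 {a} {b} eq a∸1≤2 with 2a+3b≡17⇒ a b eq
... | inj₁ (refl , refl) = refl , refl
2a+3b≡17⇒a≡1 {a} {b} eq (s≤s (s≤s ())) | inj₂ (inj₁ (refl , refl))
2a+3b≡17⇒a≡1 {a} {b} eq (s≤s (s≤s ())) | inj₂ (inj₂ (refl , refl))

t+2f≡51⇒30≤t+f : ∀ t f → t + 2 * f ≡ 51 → 6 ≤ t → t ≢ 7 → 30 ≤ t + f
t+2f≡51⇒30≤t+f t f t+2f≡51 6≤t t≢7 =
  *-cancelˡ-≤ 2 (≤-trans (+-monoˡ-≤ 51 9≤t) (≤-reflexive (trans (cong (t +_) (sym t+2f≡51)) (double t f))))
  where
  double : ∀ t f → t + (t + 2 * f) ≡ 2 * (t + f)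
  double = solve-∀
  t-odd : ∀ k → 2 * k ≢ t
  t-odd k 2k≡t = even≢odd (k + f) 25 (trans (*-distribˡ-+ 2 k f) (trans (cong (_+ 2 * f) 2k≡t) t+2f≡51))
  9≤t : 9 ≤ t
  9≤t = ≤∧≢⇒< (≤∧≢⇒< (≤∧≢⇒< 6≤t (t-odd 3)) (t≢7 ∘ sym)) (t-odd 4)

module DecompositionOfK18 (Bs : List (Block 18)) (decomposition : IsK34Decomposition 18 Bs) where

  open Incidence Bs
  open Decomposition Bs decomposition

  #triangles+2#K4s≡51 : #triangles + 2 * #K4s ≡ 51
  #triangles+2#K4s≡51 = *-cancelˡ-≡ _ 51 6 (+-cancelʳ-≡ 18 _ 306 edge-count)

  degree-17 : ∀ u → 2 * trianglesAt u + 3 * K4sAt u ≡ 17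
  degree-17 u = suc-injective (degree u)

  ∑excess : 18 + ∑[ u < 18 ] (trianglesAt u ∸ 1) ≡ 3 * #triangles
  ∑excess = ∑-excess (λ u → 2a+3b≡17⇒1≤a {trianglesAt u} {K4sAt u} (degree-17 u))

  at-least-6-triangles : 6 ≤ #triangles
  at-least-6-triangles = *-cancelˡ-≤ 3 (subst (18 ≤_) ∑excess (m≤m+n 18 _))

  not-7-triangles : #triangles ≢ 7
  not-7-triangles t≡7 =
    let x , 0<excess-x = ∑-pos⇒∃ excess (subst (0 <_) (sym ∑excess≡3) z<s)
        x-type        = 2a+3b≡17⇒a≡4 {trianglesAt x} {K4sAt x} (degree-17 x) 0<excess-x
                                     (subst (excess x ≤_) ∑excess≡3 (≤-∑ excess x))
    in Around.Exceptional.impossible x (proj₁ x-type) (proj₂ x-type) (ordinary 0<excess-x)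
    where
    excess : Fin 18 → ℕ
    excess u = trianglesAt u ∸ 1
    ∑excess≡3 : sum excess ≡ 3
    ∑excess≡3 = +-cancelˡ-≡ 18 (sum excess) 3 (trans ∑excess (cong (3 *_) t≡7))
    ordinary : ∀ {x} → 0 < excess x → ∀ u → u ≢ x → trianglesAt u ≡ 1 × K4sAt u ≡ 5
    ordinary {x} 0<excess-x u u≢x = 2a+3b≡17⇒a≡1 {trianglesAt u} {K4sAt u} (degree-17 u) (+-cancelˡ-≤ 1 (excess u) 2
      (≤-trans (+-monoˡ-≤ (excess u) 0<excess-x) (subst (excess x + excess u ≤_) ∑excess≡3 (+-≤-∑ excess (u≢x ∘ sym)))))

lemma11 : (Bs : List (Block 18)) → IsK34Decomposition 18 Bs → length Bs ≥ 30
lemma11 Bs decomposition =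
  subst (30 ≤_) (sym length≡#triangles+#K4s)
        (t+2f≡51⇒30≤t+f #triangles #K4s #triangles+2#K4s≡51 at-least-6-triangles not-7-triangles)
  where
  open Incidence Bs
  open DecompositionOfK18 Bs decomposition
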